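{- In a proper diagram, every non-regular block is incident with two adjacent arcs that cross.
   Context: A diagram of length $n$ is a simple graph on sites $\{1,\dots,n\}$ whose edges (arcs) are pairs $(s_1,s_2)$ with $s_1<s_2$ and $1<s_2-s_1<n-1$, supported by $s_1,s_2$. A diagram is binary if it has at least one arc and each site supports at most one arc. A site is free if it supports no arc; $s$ is covered by $(s_1,s_2)$ if $s_1<s<s_2$. Arcs $(s_1,s_2),(s_1',s_2')$ cross if $s_1<s_1'<s_2<s_2'$ or $s_1'<s_1<s_2'<s_2$. Two arcs are adjacent if one is supported by a site $s$ and the other by a site $s'$ with $|s-s'|=1$. A diagram is proper if it is binary, each arc covers at least one free site, and no arc covers all free sites. If $u_1<\dots<u_f$ are the free sites, $u_0=0$, $u_{f+1}=n+1$, the $i$-th block is the set of sites $s$ with $u_{i-1}<s<u_i$. An arc is incident with a block if it is supported by a site in that block. A block $B$ of a binary diagram is regular if there do not exist two sites $s_1,s_2\in B$ and two crossing arcs $e_1,e_2$ supported by $s_1$ and $s_2$ respectively; otherwise it is non-regular. -}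

module Defs where

open import Data.Nat using (ℕ; zero; suc; _+_; _∸_; _≤_; _<_)
open import Data.Product using (_×_; _,_; proj₁; proj₂; ∃-syntax)
open import Data.Sum using (_⊎_)
open import Data.List using (List)
open import Data.List.Membership.Propositional using (_∈_)
open import Relation.Nullary using (¬_)
open import Relation.Binary.PropositionalEquality using (_≡_)

Arc : Set
Arc = ℕ × ℕ

ValidArc : ℕ → Arc → Set
ValidArc n (s₁ , s₂) = (1 ≤ s₁) × (s₂ ≤ n) × (s₁ < s₂) × (1 < s₂ ∸ s₁) × (s₂ ∸ s₁ < n ∸ 1)

-- A diagram of length n: a (finite) set of arcs on sites {1,…,n}, given as a list
-- (only membership matters, so repetitions are irrelevant: a simple graph).
record Diagram (n : ℕ) : Set where
  field
    arcs  : List Arc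
    valid : ∀ {e} → e ∈ arcs → ValidArc n e
open Diagram public

Site : ℕ → ℕ → Set
Site n s = (1 ≤ s) × (s ≤ n)

SupportedBy : Arc → ℕ → Set
SupportedBy (s₁ , s₂) s = (s ≡ s₁) ⊎ (s ≡ s₂)

Covers : Arc → ℕ → Set
Covers (s₁ , s₂) s = (s₁ < s) × (s < s₂)

Cross : Arc → Arc → Set
Cross (a₁ , a₂) (b₁ , b₂) =
  ((a₁ < b₁) × (b₁ < a₂) × (a₂ < b₂)) ⊎ ((b₁ < a₁) × (a₁ < b₂) × (b₂ < a₂))

module _ {n : ℕ} (D : Diagram n) where

  Free : ℕ → Set
  Free s = Site n s × (¬ (∃[ e ] (e ∈ arcs D × SupportedBy e s)))

  Binary : Set
  Binary = (∃[ e ] (e ∈ arcs D))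
         × (∀ {e e' s} → e ∈ arcs D → e' ∈ arcs D →
              SupportedBy e s → SupportedBy e' s → e ≡ e')

  Proper : Set
  Proper = Binary
         × (∀ {e} → e ∈ arcs D → ∃[ s ] (Free s × Covers e s))
         × (∀ {e} → e ∈ arcs D → ¬ (∀ s → Free s → Covers e s))

  Adjacent : Arc → Arc → Set
  Adjacent e e' = ∃[ s ] ∃[ s' ] (SupportedBy e s × SupportedBy e' s' ×
                                   ((s' ≡ suc s) ⊎ (s ≡ suc s')))

  -- (a , b) are consecutive terms u_{i-1} < u_i of the sequence
  -- u₀ = 0 < u₁ < … < u_f < u_{f+1} = n+1, where u₁ < … < u_f are the free sites.
  -- The corresponding block is then { s | a < s < b }.
  BlockBounds : ℕ → ℕ → Set
  BlockBounds a b = (a < b)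
                  × ((a ≡ 0) ⊎ Free a)
                  × ((b ≡ suc n) ⊎ Free b)
                  × (∀ s → a < s → s < b → ¬ Free s)

  InBlock : ℕ → ℕ → ℕ → Set
  InBlock a b s = (a < s) × (s < b)

  IncidentWith : ℕ → ℕ → Arc → Set
  IncidentWith a b e = ∃[ s ] (InBlock a b s × SupportedBy e s)

  NonRegular : ℕ → ℕ → Set
  NonRegular a b = ∃[ s₁ ] ∃[ s₂ ] ∃[ e₁ ] ∃[ e₂ ]
    (InBlock a b s₁ × InBlock a b s₂ × e₁ ∈ arcs D × e₂ ∈ arcs D ×
     SupportedBy e₁ s₁ × SupportedBy e₂ s₂ × Cross e₁ e₂)

-- Every site z of a block supports an arc, and since that arc covers a free site it
-- must leave the block: it is (p , z) with p left of the block or (z , q) with q right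
-- of it. For such arcs at sites s < t, crossing means exactly key s ≺ key t, where the
-- key of (z , q) is inj₁ q, the key of (p , z) is inj₂ p, and ≺ puts inj₁ before inj₂.
-- As ≺ is cotransitive, if the arcs at s < t cross then for every s < m < t the arc at
-- m crosses one of them; shrinking [s , t] ends with crossing arcs at consecutive sites.
module Submission where

open import Defs
open import Data.Nat using (ℕ; suc; _≤_; _<_; _≟_; _<?_; s≤s; z≤n)
open import Data.Nat.Properties
  using (≤-refl; ≤-trans; <-trans; ≤-<-trans; <-≤-trans; <⇒≤; <-irrefl; <-asym; <-cmp;
         m≤n⇒m≤1+n; ≤-pred; ≮⇒≥; m<1+n⇒m<n∨m≡n)
open import Data.Product using (_×_; _,_; ∃-syntax)
open import Data.Sum using (_⊎_; inj₁; inj₂)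
import Data.Sum as Sum
open import Data.Sum.Relation.Binary.LeftOrder using (_⊎-<_; ₁∼₂; ₁∼₁; ₂∼₂)
open import Data.List.Membership.Propositional using (_∈_; find; lose)
open import Data.List.Relation.Unary.Any using (any?)
open import Data.Empty using (⊥-elim)
open import Function.Bundles using (_⇔_; mk⇔; Equivalence)
open import Relation.Binary using (Rel; Cotransitive; tri<; tri≈; tri>)
open import Relation.Nullary using (¬_; Dec; yes; no; _⊎-dec_)
open import Relation.Binary.PropositionalEquality using (_≡_; refl; subst)

<-cotransitive : Cotransitive _<_
<-cotransitive {x} x<y z with x <? z
... | yes x<z = inj₁ x<z
... | no x≮z  = inj₂ (≤-<-trans (≮⇒≥ x≮z) x<y)

⊎-<-cotransitive : ∀ {a b ℓ₁ ℓ₂} {A : Set a} {B : Set b} {∼₁ : Rel A ℓ₁} {∼₂ : Rel B ℓ₂} →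
  Cotransitive ∼₁ → Cotransitive ∼₂ → Cotransitive (∼₁ ⊎-< ∼₂)
⊎-<-cotransitive cot₁ cot₂ ₁∼₂         (inj₁ _) = inj₂ ₁∼₂
⊎-<-cotransitive cot₁ cot₂ ₁∼₂         (inj₂ _) = inj₁ ₁∼₂
⊎-<-cotransitive cot₁ cot₂ (₁∼₁ x∼y)   (inj₁ z) = Sum.map ₁∼₁ ₁∼₁ (cot₁ x∼y z)
⊎-<-cotransitive cot₁ cot₂ (₁∼₁ _)     (inj₂ _) = inj₁ ₁∼₂
⊎-<-cotransitive cot₁ cot₂ (₂∼₂ _)     (inj₁ _) = inj₂ ₁∼₂
⊎-<-cotransitive cot₁ cot₂ (₂∼₂ x∼y)   (inj₂ z) = Sum.map ₂∼₂ ₂∼₂ (cot₂ x∼y z)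

module _ {r} {R : ℕ → ℕ → Set r}
         (split : ∀ {s m t} → s < m → m < t → R s t → R s m ⊎ R m t) where

  split⇒consecutive : ∀ {s} t → s < t → R s t → ∃[ u ] R u (suc u)
  split⇒consecutive {s} (suc t) s<1+t r with m<1+n⇒m<n∨m≡n s<1+t
  ... | inj₂ refl = s , r
  ... | inj₁ s<t with split s<t ≤-refl r
  ...   | inj₁ r′ = split⇒consecutive t s<t r′
  ...   | inj₂ r′ = t , r′

Cross-sym : ∀ e e′ → Cross e e′ → Cross e′ e
Cross-sym _ _ (inj₁ c) = inj₂ c
Cross-sym _ _ (inj₂ c) = inj₁ c

Cross-irrefl : ∀ e → ¬ Cross e e
Cross-irrefl _ (inj₁ (lt , _)) = <-irrefl refl lt
Cross-irrefl _ (inj₂ (lt , _)) = <-irrefl refl lt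

supportedBy? : ∀ z e → Dec (SupportedBy e z)
supportedBy? z (s₁ , s₂) = (z ≟ s₁) ⊎-dec (z ≟ s₂)

_≺_ : Rel (ℕ ⊎ ℕ) _
_≺_ = _<_ ⊎-< _<_

module _ {n : ℕ} (D : Diagram n) (a b : ℕ) where

  CrossAt : ℕ → ℕ → Set
  CrossAt s t = ∃[ e₁ ] ∃[ e₂ ]
    (InBlock D a b s × InBlock D a b t × e₁ ∈ arcs D × e₂ ∈ arcs D ×
     SupportedBy e₁ s × SupportedBy e₂ t × Cross e₁ e₂)

  CrossAt-sym : ∀ {s t} → CrossAt s t → CrossAt t s
  CrossAt-sym (e₁ , e₂ , s∈ , t∈ , e₁∈ , e₂∈ , sup₁ , sup₂ , c) =
    e₂ , e₁ , t∈ , s∈ , e₂∈ , e₁∈ , sup₂ , sup₁ , Cross-sym e₁ e₂ c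

  CrossAt-irrefl : Binary D → ∀ {s} → ¬ CrossAt s s
  CrossAt-irrefl (_ , unique) (e₁ , e₂ , _ , _ , e₁∈ , e₂∈ , sup₁ , sup₂ , c) =
    Cross-irrefl e₂ (subst (λ e → Cross e e₂) (unique e₁∈ e₂∈ sup₁ sup₂) c)

  CrossAt-ordered : Binary D → ∀ {s₁ s₂} → CrossAt s₁ s₂ →
    ∃[ s ] ∃[ t ] (s < t × CrossAt s t)
  CrossAt-ordered binary {s₁} {s₂} c with <-cmp s₁ s₂
  ... | tri< s₁<s₂ _ _ = s₁ , s₂ , s₁<s₂ , c
  ... | tri≈ _ refl _  = ⊥-elim (CrossAt-irrefl binary c)
  ... | tri> _ _ s₂<s₁ = s₂ , s₁ , s₂<s₁ , CrossAt-sym c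

  AdjacentCrossing : Set
  AdjacentCrossing = ∃[ e₁ ] ∃[ e₂ ] (e₁ ∈ arcs D × e₂ ∈ arcs D ×
    IncidentWith D a b e₁ × IncidentWith D a b e₂ × Adjacent D e₁ e₂ × Cross e₁ e₂)

  CrossAt-consecutive⇒adjacentCrossing : ∀ {u} → CrossAt u (suc u) → AdjacentCrossing
  CrossAt-consecutive⇒adjacentCrossing {u} (e₁ , e₂ , u∈ , 1+u∈ , e₁∈ , e₂∈ , sup₁ , sup₂ , c) =
    e₁ , e₂ , e₁∈ , e₂∈ , (u , u∈ , sup₁) , (suc u , 1+u∈ , sup₂) ,
    (u , suc u , sup₁ , sup₂ , inj₁ refl) , c

  data Sided (z : ℕ) : Arc → Set where
    leftward  : ∀ {p} → p ≤ a → Sided z (p , z)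
    rightward : ∀ {q} → b ≤ q → Sided z (z , q)

  key : ∀ {z e} → Sided z e → ℕ ⊎ ℕ
  key (leftward {p} _)  = inj₂ p
  key (rightward {q} _) = inj₁ q

  Cross⇔key≺ : ∀ {s t e e′} → a < s → s < t → t < b → (σ : Sided s e) (τ : Sided t e′) →
    Cross e e′ ⇔ key σ ≺ key τ
  Cross⇔key≺ a<s s<t t<b (leftward ps≤a) (leftward pt≤a) = mk⇔
    (λ { (inj₁ (ps<pt , _ , _)) → ₂∼₂ ps<pt ; (inj₂ (_ , _ , t<s)) → ⊥-elim (<-asym s<t t<s) })
    (λ { (₂∼₂ ps<pt) → inj₁ (ps<pt , ≤-<-trans pt≤a a<s , s<t) })
  Cross⇔key≺ a<s s<t t<b (leftward ps≤a) (rightward _) = mk⇔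
    (λ { (inj₁ (_ , t<s , _)) → ⊥-elim (<-asym s<t t<s)
       ; (inj₂ (t<ps , _ , _)) → ⊥-elim (<-asym s<t (<-trans (<-≤-trans t<ps ps≤a) a<s)) })
    (λ ())
  Cross⇔key≺ a<s s<t t<b (rightward b≤qs) (leftward pt≤a) = mk⇔
    (λ _ → ₁∼₂)
    (λ _ → inj₂ (≤-<-trans pt≤a a<s , s<t , <-≤-trans t<b b≤qs))
  Cross⇔key≺ a<s s<t t<b (rightward b≤qs) (rightward _) = mk⇔
    (λ { (inj₁ (_ , _ , qs<qt)) → ₁∼₁ qs<qt ; (inj₂ (t<s , _ , _)) → ⊥-elim (<-asym s<t t<s) })
    (λ { (₁∼₁ qs<qt) → inj₁ (s<t , <-≤-trans t<b b≤qs , qs<qt) })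

  Sided-split : ∀ {s m t e₁ e e₂} → a < s → s < m → m < t → t < b →
    Sided s e₁ → Sided m e → Sided t e₂ → Cross e₁ e₂ → Cross e₁ e ⊎ Cross e e₂
  Sided-split a<s s<m m<t t<b σ₁ σ σ₂ c =
    Sum.map (Equivalence.from (Cross⇔key≺ a<s s<m (<-trans m<t t<b) σ₁ σ))
            (Equivalence.from (Cross⇔key≺ (<-trans a<s s<m) m<t t<b σ σ₂))
            (⊎-<-cotransitive <-cotransitive <-cotransitive
              (Equivalence.to (Cross⇔key≺ a<s (<-trans s<m m<t) t<b σ₁ σ₂) c) (key σ))

  module _ (covers-free : ∀ {e} → e ∈ arcs D → ∃[ f ] (Free D f × Covers e f))
           (b≤1+n : b ≤ suc n)
           (interior-nonfree : ∀ s → a < s → s < b → ¬ Free D s) where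

    Free⇒outside : ∀ {f} → Free D f → f ≤ a ⊎ b ≤ f
    Free⇒outside {f} free with a <? f | f <? b
    ... | no a≮f  | _       = inj₁ (≮⇒≥ a≮f)
    ... | yes _   | no f≮b  = inj₂ (≮⇒≥ f≮b)
    ... | yes a<f | yes f<b = ⊥-elim (interior-nonfree f a<f f<b free)

    supported⇒sided : ∀ {z} e → InBlock D a b z → e ∈ arcs D → SupportedBy e z → Sided z e
    supported⇒sided e _ e∈ _ with covers-free e∈
    supported⇒sided (_ , y) (a<z , _) e∈ (inj₁ refl) | f , free , z<f , f<y
      with Free⇒outside free
    ... | inj₁ f≤a = ⊥-elim (<-asym z<f (≤-<-trans f≤a a<z))
    ... | inj₂ b≤f = rightward (≤-trans b≤f (<⇒≤ f<y))
    supported⇒sided (x , _) (_ , z<b) e∈ (inj₂ refl) | f , free , x<f , f<z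
      with Free⇒outside free
    ... | inj₁ f≤a = leftward (<⇒≤ (<-≤-trans x<f f≤a))
    ... | inj₂ b≤f = ⊥-elim (<-asym f<z (<-≤-trans z<b b≤f))

    supporting-arc : ∀ {z} → InBlock D a b z → ∃[ e ] (e ∈ arcs D × SupportedBy e z)
    supporting-arc {z} (a<z , z<b) with any? (supportedBy? z) (arcs D)
    ... | yes some = find some
    ... | no none  =
      ⊥-elim (interior-nonfree z a<z z<b (site , λ (e , e∈ , sup) → none (lose e∈ sup)))
      where
        site : Site n z
        site = ≤-trans (s≤s z≤n) a<z , ≤-pred (<-≤-trans z<b b≤1+n)

    CrossAt-split : ∀ {s m t} → s < m → m < t → CrossAt s t → CrossAt s m ⊎ CrossAt m t
    CrossAt-split s<m m<t (e₁ , e₂ , s∈@(a<s , _) , t∈@(_ , t<b) , e₁∈ , e₂∈ , sup₁ , sup₂ , c) =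
      let m∈ = <-trans a<s s<m , <-trans m<t t<b
          e , e∈ , sup = supporting-arc m∈
      in Sum.map (λ c₁ → e₁ , e , s∈ , m∈ , e₁∈ , e∈ , sup₁ , sup , c₁)
                 (λ c₂ → e , e₂ , m∈ , t∈ , e∈ , e₂∈ , sup , sup₂ , c₂)
                 (Sided-split a<s s<m m<t t<b (supported⇒sided e₁ s∈ e₁∈ sup₁)
                   (supported⇒sided e m∈ e∈ sup) (supported⇒sided e₂ t∈ e₂∈ sup₂) c)

lemma6p1 : ∀ {n : ℕ} (D : Diagram n) → Proper D →
    ∀ (a b : ℕ) → BlockBounds D a b → NonRegular D a b →
    ∃[ e₁ ] ∃[ e₂ ] (e₁ ∈ arcs D × e₂ ∈ arcs D ×
      IncidentWith D a b e₁ × IncidentWith D a b e₂ ×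
      Adjacent D e₁ e₂ × Cross e₁ e₂)
lemma6p1 {n} D (binary , covers-free , _) a b (_ , _ , right-end , interior-nonfree) (_ , _ , c) =
  let s , t , s<t , cₛₜ = CrossAt-ordered D a b binary c
      _ , cᵤ = split⇒consecutive
                 (CrossAt-split D a b covers-free (end≤1+n right-end) interior-nonfree) t s<t cₛₜ
  in CrossAt-consecutive⇒adjacentCrossing D a b cᵤ
  where
    end≤1+n : (b ≡ suc n) ⊎ Free D b → b ≤ suc n
    end≤1+n (inj₁ refl)            = ≤-refl
    end≤1+n (inj₂ ((_ , b≤n) , _)) = m≤n⇒m≤1+n b≤n
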